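{- Let $\mathcal V_z$ be a VASZ of dimension $d$ with $\delta(a_z)\in\{0\}\times\mathbb Z^{d-1}$, $\vec f=(0,\omega,\dots,\omega)$, and $\rightsquigarrow$ the relation on $\{0\}\times\mathbb N_\omega^{d-1}$ given by $\vec x\rightsquigarrow\vec y$ iff $\vec y\in\downarrow_{\vec f}\mathrm{Lim}\,\mathrm{Post}^*(\mathcal V_z(\vec x))$. If $\vec x,\vec y\in\{0\}\times\mathbb N_\omega^{d-1}$ satisfy $\vec x\rightsquigarrow\vec y$ and $\vec x\le\vec y$, then $\vec x\rightsquigarrow(\vec x\nabla\vec y)$, where $(\vec x\nabla\vec y)(i)=\omega$ if $\vec x(i)<\vec y(i)$ and $(\vec x\nabla\vec y)(i)=\vec x(i)$ if $\vec x(i)=\vec y(i)$.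
   Context: A VASZ of dimension $d$ is $\langle A,a_z,\delta,\vec x_{in}\rangle$ with $A$ finite, $a_z\notin A$, $\delta:A\cup\{a_z\}\to\mathbb Z^d$. States lie in $\mathbb N_\omega^d$ ($\mathbb N_\omega=\mathbb N\cup\{\omega\}$, $n\le\omega$, $\omega+n=n+\omega=\omega$ for $n\in\mathbb Z$): $\vec x\xrightarrow{a}\vec y$ iff $\vec y=\vec x+\delta(a)\ge\vec0$ for $a\in A$, and $\vec x\xrightarrow{a_z}\vec y$ iff $\vec y=\vec x+\delta(a_z)\ge\vec0$ and $\vec x(1)=0$; extended to words. $\mathcal V_z(\vec x)$ is $\mathcal V_z$ with initial state $\vec x$ and $\mathrm{Post}^*$ its set of reachable states. $\le$ is componentwise on $\mathbb N_\omega^d$, $\downarrow$ its downward closure. $\vec M|_{\vec f}=\{\vec x\in\vec M\mid\forall i,\ \vec f(i)<\omega\Rightarrow\vec x(i)=\vec f(i)\}$, $\downarrow_{\vec f}\vec M=\downarrow(\vec M|_{\vec f})$. Convergence in $\mathbb N_\omega$: ultimately constant equal to $\ell$, or integer subsequence infinite tending to infinity with $\ell=\omega$; componentwise in $\mathbb N_\omega^d$; $\mathrm{Lim}\,\vec M$ is the set of limits of sequences from $\vec M$. -}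

module Defs where

open import Data.Nat using (ℕ; _≤_; _<ᵇ_)
open import Data.Integer using (ℤ; +_; _+_)
open import Data.Fin using (Fin; zero; suc)
open import Data.Bool using (if_then_else_)
open import Data.Product using (Σ; ∃; _×_; _,_)
open import Data.Sum using (_⊎_)
open import Relation.Binary.PropositionalEquality using (_≡_)
open import Relation.Binary.Construct.Closure.ReflexiveTransitive using (Star)

data ℕω : Set where
  fin : ℕ → ℕω
  ω   : ℕω

data _≤ω_ : ℕω → ℕω → Set where
  fin≤fin : ∀ {m n} → m ≤ n → fin m ≤ω fin n
  ≤ω-top  : ∀ {x} → x ≤ω ω

-- x + z = y with x, y ∈ ℕ_ω, z ∈ ℤ (ω + z = ω); y ∈ ℕ_ω encodes y ≥ 0
data AddZ : ℕω → ℤ → ℕω → Set where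
  add-fin : ∀ {m z n} → (+ m) + z ≡ + n → AddZ (fin m) z (fin n)
  add-ω   : ∀ {z} → AddZ ω z ω

-- vectors of dimension d (coordinate 1 of the paper is 'zero')
Vecω : ℕ → Set
Vecω d = Fin d → ℕω

VecZ : ℕ → Set
VecZ d = Fin d → ℤ

_≤v_ : ∀ {d} → Vecω d → Vecω d → Set
x ≤v y = ∀ i → x i ≤ω y i

-- VASZ ⟨A, a_z, δ, x_in⟩ of dimension d, with A = Fin nA
record VASZ (d : ℕ) : Set where
  field
    nA  : ℕ
    δ   : Fin nA → VecZ d
    δz  : VecZ d
    xin : Vecω d

module _ {d : ℕ} (V : VASZ (Data.Nat.suc d)) where
  open VASZ V

  data Step : Vecω (Data.Nat.suc d) → Vecω (Data.Nat.suc d) → Set where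
    stepA : ∀ {x y} (a : Fin nA) → (∀ i → AddZ (x i) (δ a i) (y i)) → Step x y
    stepZ : ∀ {x y} → x zero ≡ fin 0 → (∀ i → AddZ (x i) (δz i) (y i)) → Step x y

  Post* : Vecω (Data.Nat.suc d) → Vecω (Data.Nat.suc d) → Set
  Post* x y = Star Step x y

Converges : (ℕ → ℕω) → ℕω → Set
Converges s ℓ =
  (Σ ℕ λ N → ∀ n → N ≤ n → s n ≡ ℓ)
  ⊎ ( ℓ ≡ ω
    × (∀ N → Σ ℕ λ n → N ≤ n × Σ ℕ λ k → s n ≡ fin k)
    × (∀ B → Σ ℕ λ N → ∀ n → N ≤ n → ∀ k → s n ≡ fin k → B ≤ k))

Lim : ∀ {d} → (Vecω d → Set) → Vecω d → Set
Lim {d} M ℓ = Σ (ℕ → Vecω d) λ s → (∀ n → M (s n)) × (∀ i → Converges (λ n → s n i) (ℓ i))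

Restrict : ∀ {d} → (Vecω d → Set) → Vecω d → Vecω d → Set
Restrict M f x = M x × (∀ i (k : ℕ) → f i ≡ fin k → x i ≡ fin k)

DownF : ∀ {d} → Vecω d → (Vecω d → Set) → Vecω d → Set
DownF f M y = Σ _ λ z → Restrict M f z × (y ≤v z)

fvec : ∀ {d} → Vecω (Data.Nat.suc d)
fvec zero    = fin 0
fvec (suc _) = ω

Leads : ∀ {d} → VASZ (Data.Nat.suc d) → Vecω (Data.Nat.suc d) → Vecω (Data.Nat.suc d) → Set
Leads V x y = DownF fvec (Lim (Post* V x)) y

nab : ℕω → ℕω → ℕω
nab (fin m) (fin n) = if m <ᵇ n then ω else fin m
nab (fin m) ω       = ω
nab ω       _       = ω

_∇_ : ∀ {d} → Vecω d → Vecω d → Vecω d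
(x ∇ y) i = nab (x i) (y i)

module Submission where

-- Unfold x ⇝ y: some z with z(1) = 0 and y ≤ z is the
-- limit of reachable states s₀, s₁, … of V_z(x).  Along a run, ω-coordinates
-- stay ω and finite ones stay finite, so by convergence a single late state
-- v = s_N satisfies v(1) = 0 and v = x + D for a vector D ∈ ℕ^{d+1} with
-- D(1) = 0 and D(i) > 0 wherever x(i) < y(i).
-- VASZ are monotone under adding a vector whose first (zero-tested)
-- coordinate is 0, so the run x →* x + D can be repeated: x + k·D is
-- reachable for every k.  The sequence x + k·D converges to the vector L with
-- L(i) = x(i) where D(i) = 0 and L(i) = ω where D(i) > 0; hence L(1) = 0 and
-- x ∇ y ≤ L, which is exactly x ⇝ x ∇ y.

open import Defs
open import Data.Nat using (ℕ; suc)
open import Data.Integer using (+_)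
open import Data.Fin using (zero)
open import Relation.Binary.PropositionalEquality using (_≡_)

open import Data.Nat as N using (zero; _≤_; _<_; _⊔_; _*_; _∸_; _<ᵇ_)
import Data.Nat.Properties as NP
import Data.Integer as Z
import Data.Integer.Properties as ZP
open import Data.Fin using (Fin) renaming (suc to fsuc)
open import Data.Bool using (true; false; T)
open import Data.Product using (Σ; _×_; _,_; proj₁; proj₂)
open import Data.Sum using (inj₁; inj₂)
open import Data.Unit using (tt)
open import Relation.Binary.PropositionalEquality
  using (refl; sym; trans; cong; cong₂; subst; module ≡-Reasoning)
open import Relation.Binary.Construct.Closure.ReflexiveTransitive
  using (ε; _◅_; _◅◅_; gmap)

_⊕_ : ℕω → ℕ → ℕω
fin m ⊕ c = fin (m N.+ c)
ω     ⊕ c = ω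

⊕-identityʳ : ∀ p → p ⊕ 0 ≡ p
⊕-identityʳ (fin m) = cong fin (NP.+-identityʳ m)
⊕-identityʳ ω       = refl

⊕-assoc : ∀ p a b → (p ⊕ a) ⊕ b ≡ p ⊕ (a N.+ b)
⊕-assoc (fin m) a b = cong fin (NP.+-assoc m a b)
⊕-assoc ω       a b = refl

_≗_ : ∀ {d} → Vecω d → Vecω d → Set
p ≗ q = ∀ i → p i ≡ q i

_⊕v_ : ∀ {d} → Vecω d → (Fin d → ℕ) → Vecω d
(p ⊕v c) i = p i ⊕ c i

AddZ-shift : ∀ {p z q} c → AddZ p z q → AddZ (p ⊕ c) z (q ⊕ c)
AddZ-shift {fin m} {z} {fin n} c (add-fin m+z≡n) = add-fin (begin
    + (m N.+ c) Z.+ z     ≡⟨ cong (Z._+ z) (ZP.pos-+ m c) ⟩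
    (+ m Z.+ + c) Z.+ z   ≡⟨ ZP.+-assoc (+ m) (+ c) z ⟩
    + m Z.+ (+ c Z.+ z)   ≡⟨ cong (λ t → + m Z.+ t) (ZP.+-comm (+ c) z) ⟩
    + m Z.+ (z Z.+ + c)   ≡⟨ sym (ZP.+-assoc (+ m) z (+ c)) ⟩
    (+ m Z.+ z) Z.+ + c   ≡⟨ cong (Z._+ + c) m+z≡n ⟩
    + n Z.+ + c           ≡⟨ sym (ZP.pos-+ n c) ⟩
    + (n N.+ c)           ∎)
  where open ≡-Reasoning
AddZ-shift c add-ω = add-ω

data SameKind : ℕω → ℕω → Set where
  both-fin : ∀ {m n} → SameKind (fin m) (fin n)
  both-ω   : SameKind ω ω

SameKind-refl : ∀ p → SameKind p p
SameKind-refl (fin _) = both-fin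
SameKind-refl ω       = both-ω

SameKind-trans : ∀ {p q r} → SameKind p q → SameKind q r → SameKind p r
SameKind-trans both-fin both-fin = both-fin
SameKind-trans both-ω   both-ω   = both-ω

AddZ-sameKind : ∀ {p z q} → AddZ p z q → SameKind p q
AddZ-sameKind (add-fin _) = both-fin
AddZ-sameKind add-ω       = both-ω

-- q is reachable from p up to pointwise equality of the target
-- (Agda has no function extensionality, so vectors are compared pointwise).
ReachesUpTo : ∀ {d} → VASZ (suc d) → Vecω (suc d) → Vecω (suc d) → Set
ReachesUpTo V p q = Σ _ λ w → Post* V p w × w ≗ q

module Runs {d : ℕ} (V : VASZ (suc d)) where
  -- Monotonicity: a step stays enabled after adding c, provided c does not
  -- touch the zero-tested first coordinate.
  Step-shift : ∀ {p q} (c : Fin (suc d) → ℕ) → c zero ≡ 0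
             → Step V p q → Step V (p ⊕v c) (q ⊕v c)
  Step-shift c c₀ (stepA a add) = stepA a (λ i → AddZ-shift (c i) (add i))
  Step-shift c c₀ (stepZ p₀ add) =
    stepZ (cong₂ _⊕_ p₀ c₀) (λ i → AddZ-shift (c i) (add i))

  Post*-shift : ∀ {p q} (c : Fin (suc d) → ℕ) → c zero ≡ 0
              → Post* V p q → Post* V (p ⊕v c) (q ⊕v c)
  Post*-shift c c₀ = gmap (_⊕v c) (Step-shift c c₀)

  Step-respˡ : ∀ {p p' q} → p' ≗ p → Step V p q → Step V p' q
  Step-respˡ p'≗p (stepA a add) =
    stepA a (λ i → subst (λ u → AddZ u _ _) (sym (p'≗p i)) (add i))
  Step-respˡ p'≗p (stepZ p₀ add) =
    stepZ (trans (p'≗p zero) p₀) (λ i → subst (λ u → AddZ u _ _) (sym (p'≗p i)) (add i))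

  Post*-respˡ : ∀ {p p' q} → p' ≗ p → Post* V p q → ReachesUpTo V p' q
  Post*-respˡ {p' = p'} p'≗p ε = p' , ε , p'≗p
  Post*-respˡ {q = q} p'≗p (s ◅ r) = q , Step-respˡ p'≗p s ◅ r , λ _ → refl

  Post*-sameKind : ∀ {p q} → Post* V p q → ∀ i → SameKind (p i) (q i)
  Post*-sameKind {p} ε i = SameKind-refl (p i)
  Post*-sameKind (stepA a add ◅ r) i = SameKind-trans (AddZ-sameKind (add i)) (Post*-sameKind r i)
  Post*-sameKind (stepZ _ add ◅ r) i = SameKind-trans (AddZ-sameKind (add i)) (Post*-sameKind r i)

  pump : ∀ {x v} (D : Fin (suc d) → ℕ) → D zero ≡ 0 → Post* V x v → v ≗ (x ⊕v D)
       → ∀ k → ReachesUpTo V x (x ⊕v (λ i → k * D i))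
  pump {x} D D₀ x→v v≗x+D zero = x , ε , λ i → sym (⊕-identityʳ (x i))
  pump {x} {v} D D₀ x→v v≗x+D (suc k) = extend (pump D D₀ x→v v≗x+D k)
    where
    kD : Fin (suc d) → ℕ
    kD i = k * D i
    kD₀ : kD zero ≡ 0
    kD₀ = trans (cong (k *_) D₀) (NP.*-zeroʳ k)
    next : ∀ i → v i ⊕ kD i ≡ x i ⊕ (suc k * D i)
    next i = trans (cong (_⊕ kD i) (v≗x+D i)) (⊕-assoc (x i) (D i) (kD i))
    -- run x →* x + k·D, then the run x →* v shifted by k·D
    extend : ReachesUpTo V x (x ⊕v kD) → ReachesUpTo V x (x ⊕v (λ i → suc k * D i))
    extend (w , x→w , w≗x+kD) with Post*-respˡ w≗x+kD (Post*-shift kD kD₀ x→v)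
    ... | u , w→u , u≗v+kD = u , x→w ◅◅ w→u , λ i → trans (u≗v+kD i) (next i)

-- The limit of the arithmetic progression p, p ⊕ e, p ⊕ 2e, …
progressionLimit : ℕω → ℕ → ℕω
progressionLimit ω       _       = ω
progressionLimit (fin a) zero    = fin a
progressionLimit (fin a) (suc _) = ω

fin-injective : ∀ {a b} → fin a ≡ fin b → a ≡ b
fin-injective refl = refl

progression-converges : ∀ p e (s : ℕ → ℕω) → (∀ k → s k ≡ p ⊕ (k * e))
                      → Converges s (progressionLimit p e)
progression-converges ω e s s≡ = inj₁ (0 , λ k _ → s≡ k)
progression-converges (fin a) zero s s≡ = inj₁ (0 , λ k _ →
  trans (s≡ k) (trans (cong (fin a ⊕_) (NP.*-zeroʳ k)) (⊕-identityʳ (fin a))))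
progression-converges (fin a) (suc e) s s≡ =
  inj₂ (refl , (λ K → K , NP.≤-refl , a N.+ K * suc e , s≡ K) , λ B → B , bounded)
  where
  -- s k = a + k·(e+1) ≥ k
  bounded : ∀ {B} k → B ≤ k → ∀ b → s k ≡ fin b → B ≤ b
  bounded k B≤k b sk≡b = NP.≤-trans B≤k (subst (k ≤_) (fin-injective (trans (sym (s≡ k)) sk≡b))
    (NP.≤-trans (NP.m≤m*n k (suc e)) (NP.m≤n+m (k * suc e) a)))

Eventually : (ℕ → Set) → Set
Eventually P = Σ ℕ λ N → ∀ n → N ≤ n → P n

converges-fin : ∀ {s k} → Converges s (fin k) → Eventually (λ n → s n ≡ fin k)
converges-fin (inj₁ ev) = ev
converges-fin (inj₂ (() , _))

eventually-× : ∀ {P Q} → Eventually P → Eventually Q → Eventually (λ n → P n × Q n)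
eventually-× (M , p) (N , q) =
  M ⊔ N , λ n le → p n (NP.≤-trans (NP.m≤m⊔n M N) le) , q n (NP.≤-trans (NP.m≤n⊔m M N) le)

eventually-∀ : ∀ {m} (P : Fin m → ℕ → Set) → (∀ i → Eventually (P i))
             → Eventually (λ n → ∀ i → P i n)
eventually-∀ {zero}  P ev = 0 , λ _ _ ()
eventually-∀ {suc m} P ev
  with eventually-× (ev zero) (eventually-∀ (λ i → P (fsuc i)) (λ i → ev (fsuc i)))
... | N , h = N , λ { n le zero → proj₁ (h n le) ; n le (fsuc i) → proj₂ (h n le) i }

data _<ω_ : ℕω → ℕω → Set where
  fin<fin : ∀ {m n} → m < n → fin m <ω fin n
  fin<ω   : ∀ {m} → fin m <ω ω

<ω-≤ω-trans : ∀ {p q r} → p <ω q → q ≤ω r → p <ω r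
<ω-≤ω-trans (fin<fin m<n) (fin≤fin n≤k) = fin<fin (NP.<-≤-trans m<n n≤k)
<ω-≤ω-trans (fin<fin _)   ≤ω-top        = fin<ω
<ω-≤ω-trans fin<ω         ≤ω-top        = fin<ω

≤ω-trans : ∀ {p q r} → p ≤ω q → q ≤ω r → p ≤ω r
≤ω-trans (fin≤fin m≤n) (fin≤fin n≤k) = fin≤fin (NP.≤-trans m≤n n≤k)
≤ω-trans _             ≤ω-top        = ≤ω-top

-- v lies e above x, strictly above wherever x < y: the coordinate of a state
-- that can be pumped towards x ∇ y.
Ahead : ℕω → ℕω → ℕω → Set
Ahead x y v = Σ ℕ λ e → v ≡ x ⊕ e × (x <ω y → 0 < e)

Ahead-fin : ∀ {a b} y → a ≤ b → (fin a <ω y → a < b) → Ahead (fin a) y (fin b)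
Ahead-fin {a} {b} y a≤b strict =
  b ∸ a , cong fin (sym (NP.m+[n∸m]≡n a≤b)) , λ a<y → NP.m<n⇒0<n∸m (strict a<y)

-- If x ≤ y ≤ lim s and every s n has the kind of x, then eventually s n is
-- ahead of x: finite limits are reached exactly, and ω-limits eventually
-- exceed any finite x(i).
eventually-ahead : ∀ {x y z} (s : ℕ → ℕω) → x ≤ω y → y ≤ω z → Converges s z
                 → (∀ n → SameKind x (s n)) → Eventually (λ n → Ahead x y (s n))
eventually-ahead {ω} {y} s _ _ _ kind = 0 , λ n _ → ahead (kind n)
  where
  ahead : ∀ {v} → SameKind ω v → Ahead ω y v
  ahead both-ω = 0 , refl , λ ()
eventually-ahead {fin a} {y} s x≤y y≤z (inj₁ (N , sn≡z)) kind =
  N , λ n N≤n → ahead (sn≡z n N≤n) (kind n)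
  where
  ahead : ∀ {v} → v ≡ _ → SameKind (fin a) v → Ahead (fin a) y v
  ahead {fin b} v≡z both-fin = Ahead-fin y (unfin (≤ω-trans x≤y y≤b)) λ a<y → unfin< (<ω-≤ω-trans a<y y≤b)
    where
    y≤b : y ≤ω fin b
    y≤b = subst (y ≤ω_) (sym v≡z) y≤z
    unfin : ∀ {m n} → fin m ≤ω fin n → m ≤ n
    unfin (fin≤fin m≤n) = m≤n
    unfin< : ∀ {m n} → fin m <ω fin n → m < n
    unfin< (fin<fin m<n) = m<n
eventually-ahead {fin a} {y} s _ _ (inj₂ (_ , _ , unbounded)) kind
  with unbounded (suc a)
... | N , large = N , λ n N≤n → ahead (large n N≤n) (kind n)
  where
  ahead : ∀ {v} → (∀ b → v ≡ fin b → suc a ≤ b) → SameKind (fin a) v → Ahead (fin a) y v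
  ahead {fin b} large both-fin = Ahead-fin y (NP.<⇒≤ a<b) λ _ → a<b
    where
    a<b : a < b
    a<b = large b refl

nab-≤-limit : ∀ {x y v} → ((e , _ , strict) : Ahead x y v) → nab x y ≤ω progressionLimit x e
nab-≤-limit {ω} (e , _ , _) = ≤ω-top
nab-≤-limit {fin a} {ω} (zero , _ , strict) with strict fin<ω
... | ()
nab-≤-limit {fin a} {ω} (suc e , _ , _) = ≤ω-top
nab-≤-limit {fin a} {fin c} _ with a <ᵇ c in a<ᵇc
nab-≤-limit {fin a} {fin c} (zero , _ , strict) | true
  with strict (fin<fin (NP.<ᵇ⇒< a c (subst T (sym a<ᵇc) tt)))
... | ()
nab-≤-limit {fin a} {fin c} (suc e , _ , _) | true = ≤ω-top
nab-≤-limit {fin a} {fin c} (zero , _ , _) | false = fin≤fin NP.≤-refl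
nab-≤-limit {fin a} {fin c} (suc e , _ , _) | false = ≤ω-top

module Pumping {d : ℕ} (V : VASZ (suc d)) where
  open Runs V

  ahead-state : ∀ {x y z} (s : ℕ → Vecω (suc d)) → (∀ n → Post* V x (s n))
              → (∀ i → Converges (λ n → s n i) (z i)) → z zero ≡ fin 0
              → x ≤v y → y ≤v z
              → Σ _ λ v → Post* V x v × v zero ≡ fin 0 × (∀ i → Ahead (x i) (y i) (v i))
  ahead-state {x} {y} s x→s s→z z₀ x≤y y≤z with late
    where
    late : Eventually (λ n → s n zero ≡ fin 0 × (∀ i → Ahead (x i) (y i) (s n i)))
    late = eventually-× (converges-fin (subst (Converges _) z₀ (s→z zero)))
      (eventually-∀ _ λ i → eventually-ahead (λ n → s n i) (x≤y i) (y≤z i) (s→z i)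
                              λ n → Post*-sameKind (x→s n) i)
  ... | N , late-from = s N , x→s N , late-from N NP.≤-refl

  pumping-limit : ∀ {x v} (D : Fin (suc d) → ℕ) → D zero ≡ 0 → Post* V x v → v ≗ (x ⊕v D)
                → Lim (Post* V x) (λ i → progressionLimit (x i) (D i))
  pumping-limit {x} D D₀ x→v v≗x+D =
    (λ k → proj₁ (pumped k)) , (λ k → proj₁ (proj₂ (pumped k))) ,
    λ i → progression-converges (x i) (D i) _ (λ k → proj₂ (proj₂ (pumped k)) i)
    where
    pumped : ∀ k → ReachesUpTo V x (x ⊕v (λ i → k * D i))
    pumped = pump D D₀ x→v v≗x+D

lemma6p4 : {d : ℕ} (V : VASZ (suc d)) → VASZ.δz V zero ≡ + 0
    → (x y : Vecω (suc d)) → x zero ≡ fin 0 → y zero ≡ fin 0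
    → Leads V x y → x ≤v y → Leads V x (x ∇ y)
lemma6p4 {d} V _ x y x₀ _ (z , ((s , x→s , s→z) , z|f) , y≤z) x≤y
  with Pumping.ahead-state V s x→s s→z (z|f zero 0 refl) x≤y y≤z
... | v , x→v , v₀ , ahead =
  L , (Pumping.pumping-limit V D D₀ x→v v≗x+D , L|f) , λ i → nab-≤-limit (ahead i)
  where
  -- the pumping vector D = v - x
  D : Fin (suc d) → ℕ
  D i = proj₁ (ahead i)
  v≗x+D : v ≗ (x ⊕v D)
  v≗x+D i = proj₁ (proj₂ (ahead i))
  D₀ : D zero ≡ 0
  D₀ = sym (fin-injective (begin
    fin 0            ≡⟨ sym v₀ ⟩
    v zero           ≡⟨ v≗x+D zero ⟩
    x zero ⊕ D zero  ≡⟨ cong (_⊕ D zero) x₀ ⟩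
    fin (D zero)     ∎))
    where open ≡-Reasoning
  L : Vecω (suc d)
  L i = progressionLimit (x i) (D i)
  L|f : ∀ i k → fvec i ≡ fin k → L i ≡ fin k
  L|f zero k f≡k = trans (cong₂ progressionLimit x₀ D₀) f≡k
  L|f (fsuc i) k ()
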